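{- For every $n\in\mathbb{N}$, as formal power series in $t$ over $\mathbb{Q}(q)$, $$\frac{C_{B_{(n)}}(q,t)}{\prod_{i=0}^n (1-q^i t)} = \frac{\prod_{i=0}^{n-1} (1+q^i t)}{\prod_{i=0}^n (1-q^i t)} = \mathrm{Ehr}_{\lozenge_n, \bar{\boldsymbol{\mu}}_{(n)}} (q,t).$$
   Context: $B_{(n)}$ is the set of pairs $(w,\epsilon)$ where $w=11\dots1$ ($n$ ones) and $\epsilon:[n]\to\{\pm1\}$. Standardisation replaces the ones from left to right by $1,\dots,n$, giving the integer sequence $s_i=\epsilon(i)\cdot i$; set $s_0=0$. $\mathrm{Des}(w,\epsilon)=\{i\in\{0,\dots,n-1\}: s_i>s_{i+1}\}$, $\mathrm{maj}=\sum_{i\in\mathrm{Des}}i$, $\mathrm{des}=|\mathrm{Des}|$, $C_{B_{(n)}}(q,t)=\sum q^{\mathrm{maj}}t^{\mathrm{des}}$. $\lozenge_n=\{x\in\mathbb{R}^n:\sum|x_i|\le1\}$. For $k\ge0$ and $x\in k\lozenge_n\cap\mathbb{Z}^n$ let $\bar\mu_{k,n}(x)=\sum_{i=1}^n\bigl(k-\sum_{l=i}^n|x_l|\bigr)$, and $\mathrm{Ehr}_{\lozenge_n,\bar{\boldsymbol\mu}_{(n)}}(q,t)=\sum_{k\ge0}\sum_{x\in k\lozenge_n\cap\mathbb{Z}^n}q^{\bar\mu_{k,n}(x)}t^k$. -}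

module Defs where

open import Data.Nat using (ℕ; zero; suc; _+_; _*_; _∸_; _^_; _≡ᵇ_; _≤ᵇ_)
open import Data.Bool using (Bool; true; false; if_then_else_; _∧_)
open import Data.Integer as ℤ using (ℤ; +_; -[1+_]; ∣_∣)
open import Data.Integer.Properties as ℤP using ()
open import Data.Fin using (Fin; zero; suc; toℕ; inject₁)
open import Data.Vec using (Vec; []; _∷_; lookup)
open import Data.List using (List; []; _∷_; map; concatMap; _++_; upTo; foldr)
open import Data.Nat.ListAction using (sum)
open import Data.List using () renaming (allFin to allFinL)
open import Relation.Nullary.Decidable using (⌊_⌋)

-- Bivariate series in ℕ[q][[t]] (all series in the statement have
-- nonnegative integer coefficients and polynomial coefficients in q).
-- s k j = coefficient of t^k q^j.

Series : Set
Series = ℕ → ℕ → ℕ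

sumTo : ℕ → (ℕ → ℕ) → ℕ
sumTo zero    f = f 0
sumTo (suc n) f = sumTo n f + f (suc n)

_⋆_ : Series → Series → Series
(f ⋆ g) k j = sumTo k (λ a → sumTo j (λ b → f a b * g (k ∸ a) (j ∸ b)))

oneS : Series
oneS k j = if (k ≡ᵇ 0) ∧ (j ≡ᵇ 0) then 1 else 0

prodS : List ℕ → (ℕ → Series) → Series
prodS is F = foldr (λ i acc → F i ⋆ acc) oneS is

onePlus : ℕ → Series
onePlus i k j = if ((k ≡ᵇ 0) ∧ (j ≡ᵇ 0)) then 1
                else if ((k ≡ᵇ 1) ∧ (j ≡ᵇ i)) then 1 else 0

-- 1 / (1 - q^i t) = Σ_k q^{ik} t^k
geomInv : ℕ → Series
geomInv i k j = if j ≡ᵇ (i * k) then 1 else 0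

numer : ℕ → Series
numer n = prodS (upTo n) onePlus

invDenom : ℕ → Series
invDenom n = prodS (upTo (suc n)) geomInv

-- B_(n): signs ε : [n] → {±1}, encoded as Vec Bool n (true = +1).

allSigns : (n : ℕ) → List (Vec Bool n)
allSigns zero    = [] ∷ []
allSigns (suc n) = concatMap (λ v → (true ∷ v) ∷ (false ∷ v) ∷ []) (allSigns n)

sval : {n : ℕ} → Vec Bool n → Fin (suc n) → ℤ
sval ε zero    = + 0
sval ε (suc i) = if lookup ε i then + (suc (toℕ i)) else -[1+ toℕ i ]

-- i ∈ Des(ε)  (i ∈ {0,…,n-1})  iff  s_i > s_{i+1}
isDes : {n : ℕ} → Vec Bool n → Fin n → Bool
isDes ε i = ⌊ sval ε (suc i) ℤP.<? sval ε (inject₁ i) ⌋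

maj : {n : ℕ} → Vec Bool n → ℕ
maj {n} ε = sum (map (λ i → if isDes ε i then toℕ i else 0) (allFinL n))

des : {n : ℕ} → Vec Bool n → ℕ
des {n} ε = sum (map (λ i → if isDes ε i then 1 else 0) (allFinL n))

CB : ℕ → Series
CB n k j = sum (map (λ ε → if (des ε ≡ᵇ k) ∧ (maj ε ≡ᵇ j) then 1 else 0) (allSigns n))

intRange : ℕ → List ℤ
intRange k = map +_ (upTo (suc k)) ++ map -[1+_] (upTo k)

boxVecs : ℕ → (n : ℕ) → List (Vec ℤ n)
boxVecs k zero    = [] ∷ []
boxVecs k (suc n) = concatMap (λ a → map (a ∷_) (boxVecs k n)) (intRange k)

sumAbs : {n : ℕ} → Vec ℤ n → ℕ
sumAbs []       = 0
sumAbs (x ∷ xs) = ∣ x ∣ + sumAbs xs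

inDiamond : ℕ → {n : ℕ} → Vec ℤ n → Bool
inDiamond k x = sumAbs x ≤ᵇ k

-- μ̄_{k,n}(x) = Σ_{i=1}^n (k - Σ_{l=i}^n |x_l|)
-- (truncated subtraction; exact on k◇_n where every term is ≥ 0)
muBar : ℕ → {n : ℕ} → Vec ℤ n → ℕ
muBar k []       = 0
muBar k (x ∷ xs) = (k ∸ sumAbs (x ∷ xs)) + muBar k xs

Ehr : ℕ → Series
Ehr n k j = sum (map (λ x → if inDiamond k x ∧ (muBar k x ≡ᵇ j) then 1 else 0) (boxVecs k n))

-- A descent of (w, ε) at i is exactly a negative sign ε(i+1) = -1, because the
-- standardised sequence has |s_i| < |s_{i+1}|; hence des and maj add up
-- independently over the signs and C_{B_(n)} = ∏_{i<n} (1 + q^i t).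
--
-- On the Ehrhart side, μ̄_{k,n}(x) = n (k - |x|) + Σ_l (n - l) |x_l|.  So a lattice
-- point of k◇_n is a free choice of n integers x_l, each weighted (q^{n-l} t)^{|x_l|},
-- together with a slack k - |x| ≥ 0 weighted (q^n t)^{k - |x|}.  Summing one
-- coordinate over ℤ gives (1 + q^i t)/(1 - q^i t), and the slack gives 1/(1 - q^n t).
-- Both sides are thus instances of one product rule for generating series of
-- weighted finite lists; enumerating k◇_n inside the box [-k, k]^n is harmless
-- because the box only cuts off t-degrees above k.

module Submission where

open import Defs
open import Data.Nat using (ℕ; zero; suc; _+_; _*_; _∸_; _≤_; z≤n; s≤s; _≡ᵇ_; _≤ᵇ_)
open import Data.Nat.Properties
open import Algebra.Properties.CommutativeSemigroup +-commutativeSemigroup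
  using () renaming (interchange to +-interchange)
open import Data.Nat.ListAction using (sum)
open import Data.Nat.ListAction.Properties using (sum-++)
open import Data.Bool using (Bool; true; false; if_then_else_; _∧_; not; T)
open import Data.Unit using (tt)
open import Data.Bool.Properties using (T-≡; ∧-commutativeMonoid)
open import Data.Product using (_×_; _,_)
open import Data.Fin as Fin using (toℕ; inject₁)
open import Data.Fin.Properties using (toℕ-inject₁)
open import Data.Vec using (Vec; []; _∷_; lookup)
open import Data.Integer as ℤ using (ℤ; ∣_∣)
import Data.Integer.Properties as ℤ
open import Data.List using (List; []; _∷_; _++_; map; concatMap; upTo; downFrom; applyUpTo; tabulate; _∷ʳ_)
  renaming (allFin to allFinL)
open import Data.List.Properties using (map-++; map-∘; map-cong; map-tabulate; tabulate-cong; upTo-∷ʳ)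
open import Function using (_∘_; Equivalence)
open import Level using (0ℓ)
open import Algebra.Bundles using (CommutativeMonoid)
open import Algebra.Properties.CommutativeSemigroup (CommutativeMonoid.commutativeSemigroup ∧-commutativeMonoid)
  using () renaming (interchange to ∧-interchange)
open import Algebra.Structures using (IsCommutativeMonoid)
import Relation.Binary.Reasoning.Setoid
open import Relation.Nullary using (¬_)
open import Relation.Nullary.Decidable using (Dec; ⌊_⌋; isYes≗does; dec-true; dec-false)
open import Relation.Binary.PropositionalEquality
  using (_≡_; refl; sym; trans; cong; cong₂; subst; module ≡-Reasoning)

[_] : Bool → ℕ
[ b ] = if b then 1 else 0

[∧] : ∀ a b → [ a ∧ b ] ≡ [ a ] * [ b ]
[∧] false b = refl
[∧] true  b = sym (*-identityˡ [ b ])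

≡ᵇ-comm : ∀ m n → (m ≡ᵇ n) ≡ (n ≡ᵇ m)
≡ᵇ-comm zero    zero    = refl
≡ᵇ-comm zero    (suc n) = refl
≡ᵇ-comm (suc m) zero    = refl
≡ᵇ-comm (suc m) (suc n) = ≡ᵇ-comm m n

≤ᵇ-suc : ∀ m n → (suc m ≤ᵇ suc n) ≡ (m ≤ᵇ n)
≤ᵇ-suc zero    n = refl
≤ᵇ-suc (suc m) n = refl

≤⇒≤ᵇ≡true : ∀ {m n} → m ≤ n → (m ≤ᵇ n) ≡ true
≤⇒≤ᵇ≡true m≤n = Equivalence.to T-≡ (≤⇒≤ᵇ m≤n)

+-≡ᵇ : ∀ u v k → (u + v ≡ᵇ k) ≡ (u ≤ᵇ k) ∧ (v ≡ᵇ k ∸ u)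
+-≡ᵇ zero    v k       = refl
+-≡ᵇ (suc u) v zero    = refl
+-≡ᵇ (suc u) v (suc k) rewrite ≤ᵇ-suc u k = +-≡ᵇ u v k

[+≡ᵇ] : ∀ u v k → [ u + v ≡ᵇ k ] ≡ [ u ≤ᵇ k ] * [ v ≡ᵇ k ∸ u ]
[+≡ᵇ] u v k = trans (cong [_] (+-≡ᵇ u v k)) ([∧] (u ≤ᵇ k) (v ≡ᵇ k ∸ u))

sumTo-cong : ∀ n {f g : ℕ → ℕ} → (∀ i → i ≤ n → f i ≡ g i) → sumTo n f ≡ sumTo n g
sumTo-cong zero    f≡g = f≡g 0 z≤n
sumTo-cong (suc n) f≡g =
  cong₂ _+_ (sumTo-cong n (λ i i≤n → f≡g i (m≤n⇒m≤1+n i≤n))) (f≡g (suc n) ≤-refl)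

sumTo-zero : ∀ n → sumTo n (λ _ → 0) ≡ 0
sumTo-zero zero    = refl
sumTo-zero (suc n) = cong (_+ 0) (sumTo-zero n)

sumTo-suc : ∀ n (f : ℕ → ℕ) → sumTo (suc n) f ≡ f 0 + sumTo n (f ∘ suc)
sumTo-suc zero    f = refl
sumTo-suc (suc n) f = trans (cong (_+ f (2 + n)) (sumTo-suc n f)) (+-assoc (f 0) _ _)

sumTo-distrib-+ : ∀ n (f g : ℕ → ℕ) → sumTo n (λ i → f i + g i) ≡ sumTo n f + sumTo n g
sumTo-distrib-+ zero    f g = refl
sumTo-distrib-+ (suc n) f g = trans (cong (_+ (f (suc n) + g (suc n))) (sumTo-distrib-+ n f g))
  (+-interchange (sumTo n f) (sumTo n g) (f (suc n)) (g (suc n)))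

*-distribˡ-sumTo : ∀ n c (f : ℕ → ℕ) → c * sumTo n f ≡ sumTo n (λ i → c * f i)
*-distribˡ-sumTo zero    c f = refl
*-distribˡ-sumTo (suc n) c f =
  trans (*-distribˡ-+ c (sumTo n f) (f (suc n))) (cong (_+ c * f (suc n)) (*-distribˡ-sumTo n c f))

*-distribʳ-sumTo : ∀ n c (f : ℕ → ℕ) → sumTo n f * c ≡ sumTo n (λ i → f i * c)
*-distribʳ-sumTo n c f = trans (*-comm (sumTo n f) c)
  (trans (*-distribˡ-sumTo n c f) (sumTo-cong n (λ i _ → *-comm c (f i))))

sumTo-reverse : ∀ n (f : ℕ → ℕ) → sumTo n f ≡ sumTo n (λ i → f (n ∸ i))
sumTo-reverse zero    f = refl
sumTo-reverse (suc n) f = begin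
  sumTo n f + f (suc n)                 ≡⟨ +-comm (sumTo n f) _ ⟩
  f (suc n) + sumTo n f                 ≡⟨ cong (f (suc n) +_) (sumTo-reverse n f) ⟩
  f (suc n) + sumTo n (λ i → f (n ∸ i)) ≡⟨ sym (sumTo-suc n (λ i → f (suc n ∸ i))) ⟩
  sumTo (suc n) (λ i → f (suc n ∸ i))   ∎
  where open ≡-Reasoning

sumTo-comm : ∀ n m (F : ℕ → ℕ → ℕ) →
  sumTo n (λ a → sumTo m (F a)) ≡ sumTo m (λ b → sumTo n (λ a → F a b))
sumTo-comm zero    m F = refl
sumTo-comm (suc n) m F = trans (cong (_+ sumTo m (F (suc n))) (sumTo-comm n m F))
  (sym (sumTo-distrib-+ m (λ b → sumTo n (λ a → F a b)) (F (suc n))))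

sumTo-triangle : ∀ n (Φ : ℕ → ℕ → ℕ) →
  sumTo n (λ a → sumTo a (Φ a)) ≡ sumTo n (λ c → sumTo (n ∸ c) (λ a → Φ (c + a) c))
sumTo-triangle zero    Φ = refl
sumTo-triangle (suc n) Φ = begin
  sumTo (suc n) (λ a → sumTo a (Φ a))
    ≡⟨ sumTo-suc n _ ⟩
  Φ 0 0 + sumTo n (λ a → sumTo (suc a) (Φ (suc a)))
    ≡⟨ cong (Φ 0 0 +_) (sumTo-cong n (λ a _ → sumTo-suc a (Φ (suc a)))) ⟩
  Φ 0 0 + sumTo n (λ a → Φ (suc a) 0 + sumTo a (Φ (suc a) ∘ suc))
    ≡⟨ cong (Φ 0 0 +_) (sumTo-distrib-+ n _ _) ⟩
  Φ 0 0 + (sumTo n (λ a → Φ (suc a) 0) + sumTo n (λ a → sumTo a (Φ (suc a) ∘ suc)))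
    ≡⟨ sym (+-assoc (Φ 0 0) _ _) ⟩
  (Φ 0 0 + sumTo n (λ a → Φ (suc a) 0)) + sumTo n (λ a → sumTo a (Φ (suc a) ∘ suc))
    ≡⟨ cong₂ _+_ (sym (sumTo-suc n (λ a → Φ a 0))) (sumTo-triangle n (λ a c → Φ (suc a) (suc c))) ⟩
  sumTo (suc n) (λ a → Φ a 0) + sumTo n (λ c → sumTo (n ∸ c) (λ a → Φ (suc (c + a)) (suc c)))
    ≡⟨ sym (sumTo-suc n _) ⟩
  sumTo (suc n) (λ c → sumTo (suc n ∸ c) (λ a → Φ (c + a) c)) ∎
  where open ≡-Reasoning

sumTo-δ : ∀ n o (h : ℕ → ℕ) → sumTo n (λ b → [ o ≡ᵇ b ] * h b) ≡ [ o ≤ᵇ n ] * h o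
sumTo-δ zero    zero    h = refl
sumTo-δ zero    (suc o) h = refl
sumTo-δ (suc n) zero    h = begin
  sumTo (suc n) (λ b → [ 0 ≡ᵇ b ] * h b) ≡⟨ sumTo-suc n _ ⟩
  (h 0 + 0) + sumTo n (λ _ → 0)          ≡⟨ cong ((h 0 + 0) +_) (sumTo-zero n) ⟩
  (h 0 + 0) + 0                          ≡⟨ +-identityʳ _ ⟩
  h 0 + 0                                ∎
  where open ≡-Reasoning
sumTo-δ (suc n) (suc o) h = begin
  sumTo (suc n) (λ b → [ suc o ≡ᵇ b ] * h b)       ≡⟨ sumTo-suc n _ ⟩
  sumTo n (λ b → [ o ≡ᵇ b ] * h (suc b))           ≡⟨ sumTo-δ n o (h ∘ suc) ⟩
  [ o ≤ᵇ n ] * h (suc o)                           ≡⟨ cong (λ b → [ b ] * h (suc o)) (sym (≤ᵇ-suc o n)) ⟩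
  [ suc o ≤ᵇ suc n ] * h (suc o)                   ∎
  where open ≡-Reasoning

module _ {A : Set} where

  sum-map-cong : ∀ (xs : List A) {f g : A → ℕ} → (∀ x → f x ≡ g x) → sum (map f xs) ≡ sum (map g xs)
  sum-map-cong xs f≡g = cong sum (map-cong f≡g xs)

  sum-map-zero : ∀ (xs : List A) → sum (map (λ _ → 0) xs) ≡ 0
  sum-map-zero []       = refl
  sum-map-zero (x ∷ xs) = sum-map-zero xs

  sum-map-++ : ∀ (xs ys : List A) (f : A → ℕ) → sum (map f (xs ++ ys)) ≡ sum (map f xs) + sum (map f ys)
  sum-map-++ xs ys f = trans (cong sum (map-++ f xs ys)) (sum-++ (map f xs) (map f ys))

  *-distribˡ-sum-map : ∀ c (xs : List A) (f : A → ℕ) → c * sum (map f xs) ≡ sum (map (λ x → c * f x) xs)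
  *-distribˡ-sum-map c []       f = *-zeroʳ c
  *-distribˡ-sum-map c (x ∷ xs) f =
    trans (*-distribˡ-+ c (f x) (sum (map f xs))) (cong (c * f x +_) (*-distribˡ-sum-map c xs f))

  *-distribʳ-sum-map : ∀ c (xs : List A) (f : A → ℕ) → sum (map f xs) * c ≡ sum (map (λ x → f x * c) xs)
  *-distribʳ-sum-map c []       f = refl
  *-distribʳ-sum-map c (x ∷ xs) f =
    trans (*-distribʳ-+ c (f x) (sum (map f xs))) (cong (f x * c +_) (*-distribʳ-sum-map c xs f))

  sumTo-sum-map-comm : ∀ n (xs : List A) (F : ℕ → A → ℕ) →
    sumTo n (λ i → sum (map (F i) xs)) ≡ sum (map (λ x → sumTo n (λ i → F i x)) xs)
  sumTo-sum-map-comm n []       F = sumTo-zero n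
  sumTo-sum-map-comm n (x ∷ xs) F = trans (sumTo-distrib-+ n (λ i → F i x) _)
    (cong (sumTo n (λ i → F i x) +_) (sumTo-sum-map-comm n xs F))

  sum-concatMap : ∀ {B : Set} (xs : List B) (G : B → List A) (f : A → ℕ) →
    sum (map f (concatMap G xs)) ≡ sum (map (λ x → sum (map f (G x))) xs)
  sum-concatMap []       G f = refl
  sum-concatMap (x ∷ xs) G f =
    trans (sum-map-++ (G x) (concatMap G xs) f) (cong (sum (map f (G x)) +_) (sum-concatMap xs G f))

infix 4 _≈_
_≈_ : Series → Series → Set
f ≈ g = ∀ k j → f k j ≡ g k j

⋆-cong : ∀ {f f′ g g′} → f ≈ f′ → g ≈ g′ → (f ⋆ g) ≈ (f′ ⋆ g′)
⋆-cong f≈f′ g≈g′ k j =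
  sumTo-cong k (λ a _ → sumTo-cong j (λ b _ → cong₂ _*_ (f≈f′ a b) (g≈g′ (k ∸ a) (j ∸ b))))

⋆-congˡ : ∀ f {g g′} → g ≈ g′ → (f ⋆ g) ≈ (f ⋆ g′)
⋆-congˡ f g≈g′ = ⋆-cong {f = f} (λ _ _ → refl) g≈g′

⋆-congʳ : ∀ {f f′} g → f ≈ f′ → (f ⋆ g) ≈ (f′ ⋆ g)
⋆-congʳ g f≈f′ = ⋆-cong {g = g} f≈f′ (λ _ _ → refl)

⋆-comm : ∀ f g → (f ⋆ g) ≈ (g ⋆ f)
⋆-comm f g k j = begin
  sumTo k (λ a → sumTo j (λ b → f a b * g (k ∸ a) (j ∸ b)))
    ≡⟨ sumTo-reverse k _ ⟩
  sumTo k (λ a → sumTo j (λ b → f (k ∸ a) b * g (k ∸ (k ∸ a)) (j ∸ b)))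
    ≡⟨ sumTo-cong k (λ a a≤k → trans (sumTo-reverse j _) (sumTo-cong j (λ b b≤j → swap a b a≤k b≤j))) ⟩
  sumTo k (λ a → sumTo j (λ b → g a b * f (k ∸ a) (j ∸ b))) ∎
  where
  open ≡-Reasoning
  swap : ∀ a b → a ≤ k → b ≤ j →
    f (k ∸ a) (j ∸ b) * g (k ∸ (k ∸ a)) (j ∸ (j ∸ b)) ≡ g a b * f (k ∸ a) (j ∸ b)
  swap a b a≤k b≤j rewrite m∸[m∸n]≡n a≤k | m∸[m∸n]≡n b≤j = *-comm (f (k ∸ a) (j ∸ b)) (g a b)

⋆-assoc : ∀ f g h → ((f ⋆ g) ⋆ h) ≈ (f ⋆ (g ⋆ h))
⋆-assoc f g h k j = begin
  sumTo k (λ a → sumTo j (λ b → sumTo a (λ c → sumTo b (λ d → f c d * g (a ∸ c) (b ∸ d))) * h (k ∸ a) (j ∸ b)))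
    ≡⟨ sumTo-cong k (λ a _ → sumTo-cong j (λ b _ →
         trans (*-distribʳ-sumTo a _ _) (sumTo-cong a (λ c _ → *-distribʳ-sumTo b _ _)))) ⟩
  sumTo k (λ a → sumTo j (λ b → sumTo a (λ c → sumTo b (λ d → f c d * g (a ∸ c) (b ∸ d) * h (k ∸ a) (j ∸ b)))))
    ≡⟨ sumTo-cong k (λ a _ → sumTo-comm j a _) ⟩
  sumTo k (λ a → sumTo a (λ c → sumTo j (λ b → sumTo b (λ d → f c d * g (a ∸ c) (b ∸ d) * h (k ∸ a) (j ∸ b)))))
    ≡⟨ sumTo-triangle k _ ⟩
  sumTo k (λ c → sumTo (k ∸ c) (λ a → sumTo j (λ b → sumTo b (λ d →
    f c d * g (c + a ∸ c) (b ∸ d) * h (k ∸ (c + a)) (j ∸ b)))))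
    ≡⟨ sumTo-cong k (λ c _ → sumTo-cong (k ∸ c) (λ a _ → sumTo-triangle j _)) ⟩
  sumTo k (λ c → sumTo (k ∸ c) (λ a → sumTo j (λ d → sumTo (j ∸ d) (λ b →
    f c d * g (c + a ∸ c) (d + b ∸ d) * h (k ∸ (c + a)) (j ∸ (d + b))))))
    ≡⟨ sumTo-cong k (λ c _ → sumTo-comm (k ∸ c) j _) ⟩
  sumTo k (λ c → sumTo j (λ d → sumTo (k ∸ c) (λ a → sumTo (j ∸ d) (λ b →
    f c d * g (c + a ∸ c) (d + b ∸ d) * h (k ∸ (c + a)) (j ∸ (d + b))))))
    ≡⟨ sumTo-cong k (λ c _ → sumTo-cong j (λ d _ →
         sumTo-cong (k ∸ c) (λ a _ → sumTo-cong (j ∸ d) (λ b _ → reindex c d a b)))) ⟩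
  sumTo k (λ c → sumTo j (λ d → sumTo (k ∸ c) (λ a → sumTo (j ∸ d) (λ b →
    f c d * (g a b * h (k ∸ c ∸ a) (j ∸ d ∸ b))))))
    ≡⟨ sumTo-cong k (λ c _ → sumTo-cong j (λ d _ → sym (trans (*-distribˡ-sumTo (k ∸ c) (f c d) _)
         (sumTo-cong (k ∸ c) (λ a _ → *-distribˡ-sumTo (j ∸ d) (f c d) _))))) ⟩
  sumTo k (λ c → sumTo j (λ d → f c d * sumTo (k ∸ c) (λ a → sumTo (j ∸ d) (λ b →
    g a b * h (k ∸ c ∸ a) (j ∸ d ∸ b))))) ∎
  where
  open ≡-Reasoning
  reindex : ∀ c d a b → f c d * g (c + a ∸ c) (d + b ∸ d) * h (k ∸ (c + a)) (j ∸ (d + b))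
                      ≡ f c d * (g a b * h (k ∸ c ∸ a) (j ∸ d ∸ b))
  reindex c d a b rewrite m+n∸m≡n c a | m+n∸m≡n d b | ∸-+-assoc k c a | ∸-+-assoc j d b =
    *-assoc (f c d) (g a b) (h (k ∸ (c + a)) (j ∸ (d + b)))

genSeries : {A : Set} → List A → (A → ℕ) → (A → ℕ) → Series
genSeries xs d w k j = sum (map (λ x → [ (d x ≡ᵇ k) ∧ (w x ≡ᵇ j) ]) xs)

genSeries-singleton : ∀ {A : Set} (x : A) → genSeries (x ∷ []) (λ _ → 0) (λ _ → 0) ≈ oneS
genSeries-singleton x zero    zero    = refl
genSeries-singleton x zero    (suc j) = refl
genSeries-singleton x (suc k) zero    = refl
genSeries-singleton x (suc k) (suc j) = refl

sumTo-δ² : ∀ k j u v (G : Series) →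
  sumTo k (λ a → sumTo j (λ b → [ (u ≡ᵇ a) ∧ (v ≡ᵇ b) ] * G (k ∸ a) (j ∸ b)))
  ≡ [ (u ≤ᵇ k) ∧ (v ≤ᵇ j) ] * G (k ∸ u) (j ∸ v)
sumTo-δ² k j u v G = begin
  sumTo k (λ a → sumTo j (λ b → [ (u ≡ᵇ a) ∧ (v ≡ᵇ b) ] * G (k ∸ a) (j ∸ b)))
    ≡⟨ sumTo-cong k (λ a _ → trans (sumTo-cong j (λ b _ → split a b)) (sym (*-distribˡ-sumTo j [ u ≡ᵇ a ] _))) ⟩
  sumTo k (λ a → [ u ≡ᵇ a ] * sumTo j (λ b → [ v ≡ᵇ b ] * G (k ∸ a) (j ∸ b)))
    ≡⟨ sumTo-cong k (λ a _ → cong ([ u ≡ᵇ a ] *_) (sumTo-δ j v (λ b → G (k ∸ a) (j ∸ b)))) ⟩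
  sumTo k (λ a → [ u ≡ᵇ a ] * ([ v ≤ᵇ j ] * G (k ∸ a) (j ∸ v)))
    ≡⟨ sumTo-δ k u (λ a → [ v ≤ᵇ j ] * G (k ∸ a) (j ∸ v)) ⟩
  [ u ≤ᵇ k ] * ([ v ≤ᵇ j ] * G (k ∸ u) (j ∸ v))
    ≡⟨ sym (trans (cong (_* G (k ∸ u) (j ∸ v)) ([∧] (u ≤ᵇ k) (v ≤ᵇ j))) (*-assoc [ u ≤ᵇ k ] [ v ≤ᵇ j ] (G (k ∸ u) (j ∸ v)))) ⟩
  [ (u ≤ᵇ k) ∧ (v ≤ᵇ j) ] * G (k ∸ u) (j ∸ v) ∎
  where
  open ≡-Reasoning
  split : ∀ a b → [ (u ≡ᵇ a) ∧ (v ≡ᵇ b) ] * G (k ∸ a) (j ∸ b) ≡ [ u ≡ᵇ a ] * ([ v ≡ᵇ b ] * G (k ∸ a) (j ∸ b))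
  split a b = trans (cong (_* G (k ∸ a) (j ∸ b)) ([∧] (u ≡ᵇ a) (v ≡ᵇ b))) (*-assoc [ u ≡ᵇ a ] [ v ≡ᵇ b ] (G (k ∸ a) (j ∸ b)))

genSeries-⋆ : ∀ {A : Set} (xs : List A) (d w : A → ℕ) (G : Series) k j →
  (genSeries xs d w ⋆ G) k j ≡ sum (map (λ x → [ (d x ≤ᵇ k) ∧ (w x ≤ᵇ j) ] * G (k ∸ d x) (j ∸ w x)) xs)
genSeries-⋆ xs d w G k j = begin
  sumTo k (λ a → sumTo j (λ b → genSeries xs d w a b * G (k ∸ a) (j ∸ b)))
    ≡⟨ sumTo-cong k (λ a _ → sumTo-cong j (λ b _ → *-distribʳ-sum-map (G (k ∸ a) (j ∸ b)) xs _)) ⟩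
  sumTo k (λ a → sumTo j (λ b → sum (map (λ x → [ (d x ≡ᵇ a) ∧ (w x ≡ᵇ b) ] * G (k ∸ a) (j ∸ b)) xs)))
    ≡⟨ sumTo-cong k (λ a _ → sumTo-sum-map-comm j xs _) ⟩
  sumTo k (λ a → sum (map (λ x → sumTo j (λ b → [ (d x ≡ᵇ a) ∧ (w x ≡ᵇ b) ] * G (k ∸ a) (j ∸ b))) xs))
    ≡⟨ sumTo-sum-map-comm k xs _ ⟩
  sum (map (λ x → sumTo k (λ a → sumTo j (λ b → [ (d x ≡ᵇ a) ∧ (w x ≡ᵇ b) ] * G (k ∸ a) (j ∸ b)))) xs)
    ≡⟨ sum-map-cong xs (λ x → sumTo-δ² k j (d x) (w x) G) ⟩
  sum (map (λ x → [ (d x ≤ᵇ k) ∧ (w x ≤ᵇ j) ] * G (k ∸ d x) (j ∸ w x)) xs) ∎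
  where open ≡-Reasoning

genSeries-concatMap : ∀ {A B C : Set} (xs : List A) (ys : List B) (c : A → B → C)
  {d w : C → ℕ} {dA wA : A → ℕ} {dB wB : B → ℕ} →
  (∀ a b → d (c a b) ≡ dA a + dB b) → (∀ a b → w (c a b) ≡ wA a + wB b) →
  genSeries (concatMap (λ a → map (c a) ys) xs) d w ≈ (genSeries xs dA wA ⋆ genSeries ys dB wB)
genSeries-concatMap xs ys c {d} {w} {dA} {wA} {dB} {wB} d≡ w≡ k j = begin
  genSeries (concatMap (λ a → map (c a) ys) xs) d w k j
    ≡⟨ sum-concatMap xs (λ a → map (c a) ys) _ ⟩
  sum (map (λ a → sum (map (λ z → [ (d z ≡ᵇ k) ∧ (w z ≡ᵇ j) ]) (map (c a) ys))) xs)
    ≡⟨ sum-map-cong xs (λ a → trans (cong sum (sym (map-∘ ys)))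
         (trans (sum-map-cong ys (split a)) (sym (*-distribˡ-sum-map [ (dA a ≤ᵇ k) ∧ (wA a ≤ᵇ j) ] ys (λ b → [ (dB b ≡ᵇ k ∸ dA a) ∧ (wB b ≡ᵇ j ∸ wA a) ]))))) ⟩
  sum (map (λ a → [ (dA a ≤ᵇ k) ∧ (wA a ≤ᵇ j) ] * genSeries ys dB wB (k ∸ dA a) (j ∸ wA a)) xs)
    ≡⟨ sym (genSeries-⋆ xs dA wA (genSeries ys dB wB) k j) ⟩
  (genSeries xs dA wA ⋆ genSeries ys dB wB) k j ∎
  where
  open ≡-Reasoning
  split : ∀ a b → [ (d (c a b) ≡ᵇ k) ∧ (w (c a b) ≡ᵇ j) ]
                ≡ [ (dA a ≤ᵇ k) ∧ (wA a ≤ᵇ j) ] * [ (dB b ≡ᵇ k ∸ dA a) ∧ (wB b ≡ᵇ j ∸ wA a) ]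
  split a b rewrite d≡ a b | w≡ a b | +-≡ᵇ (dA a) (dB b) k | +-≡ᵇ (wA a) (wB b) j =
    trans (cong [_] (∧-interchange (dA a ≤ᵇ k) (dB b ≡ᵇ k ∸ dA a) (wA a ≤ᵇ j) (wB b ≡ᵇ j ∸ wA a)))
          ([∧] ((dA a ≤ᵇ k) ∧ (wA a ≤ᵇ j)) ((dB b ≡ᵇ k ∸ dA a) ∧ (wB b ≡ᵇ j ∸ wA a)))

⋆-identityˡ : ∀ f → (oneS ⋆ f) ≈ f
⋆-identityˡ f k j = begin
  (oneS ⋆ f) k j                                       ≡⟨ ⋆-congʳ f (λ k j → sym (genSeries-singleton 0 k j)) k j ⟩
  (genSeries (0 ∷ []) (λ _ → 0) (λ _ → 0) ⋆ f) k j     ≡⟨ genSeries-⋆ (0 ∷ []) (λ _ → 0) (λ _ → 0) f k j ⟩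
  f k j + 0 + 0                                        ≡⟨ +-identityʳ _ ⟩
  f k j + 0                                            ≡⟨ +-identityʳ _ ⟩
  f k j                                                ∎
  where open ≡-Reasoning

⋆-isCommutativeMonoid : IsCommutativeMonoid _≈_ _⋆_ oneS
⋆-isCommutativeMonoid = record
  { isMonoid = record
    { isSemigroup = record
      { isMagma = record
        { isEquivalence = record
          { refl  = λ _ _ → refl
          ; sym   = λ f≈g k j → sym (f≈g k j)
          ; trans = λ f≈g g≈h k j → trans (f≈g k j) (g≈h k j)
          }
        ; ∙-cong = ⋆-cong
        }
      ; assoc = ⋆-assoc
      }
    ; identity = ⋆-identityˡ , λ f k j → trans (⋆-comm f oneS k j) (⋆-identityˡ f k j)
    }
  ; comm = ⋆-comm
  }

⋆-commutativeMonoid : CommutativeMonoid 0ℓ 0ℓ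
⋆-commutativeMonoid = record { isCommutativeMonoid = ⋆-isCommutativeMonoid }

module ⋆ = CommutativeMonoid ⋆-commutativeMonoid
open import Algebra.Properties.CommutativeSemigroup ⋆.commutativeSemigroup
  using () renaming (interchange to ⋆-interchange)
module ≈-Reasoning = Relation.Binary.Reasoning.Setoid ⋆.setoid

prodS-∷ʳ : ∀ xs y (F : ℕ → Series) → prodS (xs ∷ʳ y) F ≈ (prodS xs F ⋆ F y)
prodS-∷ʳ []       y F = begin
  F y ⋆ oneS ≈⟨ ⋆-comm (F y) oneS ⟩
  oneS ⋆ F y ∎
  where open ≈-Reasoning
prodS-∷ʳ (x ∷ xs) y F = begin
  F x ⋆ prodS (xs ∷ʳ y) F   ≈⟨ ⋆-congˡ (F x) (prodS-∷ʳ xs y F) ⟩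
  F x ⋆ (prodS xs F ⋆ F y)  ≈⟨ ⋆-assoc (F x) (prodS xs F) (F y) ⟨
  (F x ⋆ prodS xs F) ⋆ F y  ∎
  where open ≈-Reasoning

prodS-upTo-suc : ∀ n (F : ℕ → Series) → prodS (upTo (suc n)) F ≈ (prodS (upTo n) F ⋆ F n)
prodS-upTo-suc n F = subst (λ l → prodS l F ≈ (prodS (upTo n) F ⋆ F n)) (upTo-∷ʳ n) (prodS-∷ʳ (upTo n) n F)

prodS-upTo≈downFrom : ∀ n (F : ℕ → Series) → prodS (upTo n) F ≈ prodS (downFrom n) F
prodS-upTo≈downFrom zero    F = ⋆.refl
prodS-upTo≈downFrom (suc n) F = begin
  prodS (upTo (suc n)) F    ≈⟨ prodS-upTo-suc n F ⟩
  prodS (upTo n) F ⋆ F n    ≈⟨ ⋆-comm (prodS (upTo n) F) (F n) ⟩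
  F n ⋆ prodS (upTo n) F    ≈⟨ ⋆-congˡ (F n) (prodS-upTo≈downFrom n F) ⟩
  F n ⋆ prodS (downFrom n) F ∎
  where open ≈-Reasoning

prodS-⋆-distrib : ∀ xs (F G : ℕ → Series) → prodS xs (λ i → F i ⋆ G i) ≈ (prodS xs F ⋆ prodS xs G)
prodS-⋆-distrib []       F G = ⋆.sym (⋆.identityˡ oneS)
prodS-⋆-distrib (x ∷ xs) F G = begin
  (F x ⋆ G x) ⋆ prodS xs (λ i → F i ⋆ G i)  ≈⟨ ⋆-congˡ (F x ⋆ G x) (prodS-⋆-distrib xs F G) ⟩
  (F x ⋆ G x) ⋆ (prodS xs F ⋆ prodS xs G)   ≈⟨ ⋆-interchange (F x) (G x) (prodS xs F) (prodS xs G) ⟩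
  (F x ⋆ prodS xs F) ⋆ (G x ⋆ prodS xs G)   ∎
  where open ≈-Reasoning

negPart : ℕ → Bool → ℕ
negPart o b = if b then 0 else o

-- Σ_{i : ε(i+1) = -1} f i, positions i counted from 0 as in Des
sumNeg : ∀ {n} → (ℕ → ℕ) → Vec Bool n → ℕ
sumNeg f []      = 0
sumNeg f (b ∷ ε) = negPart (f 0) b + sumNeg (f ∘ suc) ε

isYes-true : ∀ {A : Set} (a? : Dec A) → A → ⌊ a? ⌋ ≡ true
isYes-true a? a = trans (isYes≗does a?) (dec-true a? a)

isYes-false : ∀ {A : Set} (a? : Dec A) → ¬ A → ⌊ a? ⌋ ≡ false
isYes-false a? ¬a = trans (isYes≗does a?) (dec-false a? ¬a)

isDes≡not-lookup : ∀ {n} (ε : Vec Bool n) i → isDes ε i ≡ not (lookup ε i)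
isDes≡not-lookup ε Fin.zero with lookup ε Fin.zero
... | true  = refl
... | false = refl
isDes≡not-lookup ε (Fin.suc i) with lookup ε (Fin.suc i) | lookup ε (inject₁ i)
... | true  | true  rewrite toℕ-inject₁ i = isYes-false _ (ℤ.<-asym (ℤ.+<+ (n<1+n (suc (toℕ i)))))
... | true  | false = refl
... | false | true  = refl
... | false | false rewrite toℕ-inject₁ i = isYes-true _ (ℤ.-<- (n<1+n (toℕ i)))

sum-tabulate-not-lookup : ∀ {n} (ε : Vec Bool n) (f : ℕ → ℕ) →
  sum (tabulate (λ i → if not (lookup ε i) then f (toℕ i) else 0)) ≡ sumNeg f ε
sum-tabulate-not-lookup []          f = refl
sum-tabulate-not-lookup (true  ∷ ε) f = sum-tabulate-not-lookup ε (f ∘ suc)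
sum-tabulate-not-lookup (false ∷ ε) f = cong (f 0 +_) (sum-tabulate-not-lookup ε (f ∘ suc))

sum-isDes≡sumNeg : ∀ {n} (ε : Vec Bool n) (f : ℕ → ℕ) →
  sum (map (λ i → if isDes ε i then f (toℕ i) else 0) (allFinL n)) ≡ sumNeg f ε
sum-isDes≡sumNeg ε f = trans (cong sum (trans (map-tabulate (λ i → i) _) (tabulate-cong descent)))
  (sum-tabulate-not-lookup ε f)
  where
  descent : ∀ i → (if isDes ε i then f (toℕ i) else 0) ≡ (if not (lookup ε i) then f (toℕ i) else 0)
  descent i = cong (λ b → if b then f (toℕ i) else 0) (isDes≡not-lookup ε i)

CB≈genSeries : ∀ n → CB n ≈ genSeries (allSigns n) (sumNeg (λ _ → 1)) (sumNeg (λ i → i))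
CB≈genSeries n k j = sum-map-cong (allSigns n) (λ ε →
  cong₂ (λ d m → [ (d ≡ᵇ k) ∧ (m ≡ᵇ j) ]) (sum-isDes≡sumNeg ε (λ _ → 1)) (sum-isDes≡sumNeg ε (λ i → i)))

onePlus≈genSeries : ∀ o → onePlus o ≈ genSeries (true ∷ false ∷ []) (negPart 1) (negPart o)
onePlus≈genSeries o zero          zero    = refl
onePlus≈genSeries o zero          (suc j) = refl
onePlus≈genSeries o 1             j       = trans (cong [_] (≡ᵇ-comm j o)) (sym (+-identityʳ [ o ≡ᵇ j ]))
onePlus≈genSeries o (suc (suc k)) j       = refl

genSeries-allSigns : ∀ n (f : ℕ → ℕ) →
  genSeries (allSigns n) (sumNeg (λ _ → 1)) (sumNeg f) ≈ prodS (applyUpTo f n) onePlus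
genSeries-allSigns zero    f = genSeries-singleton {A = Vec Bool 0} []
genSeries-allSigns (suc n) f = begin
  genSeries (allSigns (suc n)) (sumNeg (λ _ → 1)) (sumNeg f)
    ≈⟨ genSeries-concatMap (allSigns n) (true ∷ false ∷ []) (λ ε b → b ∷ ε)
         {sumNeg (λ _ → 1)} {sumNeg f} {sumNeg (λ _ → 1)} {sumNeg (f ∘ suc)} {negPart 1} {negPart (f 0)}
         (λ ε b → +-comm (negPart 1 b) (sumNeg (λ _ → 1) ε)) (λ ε b → +-comm (negPart (f 0) b) (sumNeg (f ∘ suc) ε)) ⟩
  genSeries (allSigns n) (sumNeg (λ _ → 1)) (sumNeg (f ∘ suc)) ⋆ genSeries (true ∷ false ∷ []) (negPart 1) (negPart (f 0))
    ≈⟨ ⋆-cong (genSeries-allSigns n (f ∘ suc)) (⋆.sym (onePlus≈genSeries (f 0))) ⟩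
  prodS (applyUpTo (f ∘ suc) n) onePlus ⋆ onePlus (f 0)
    ≈⟨ ⋆-comm (prodS (applyUpTo (f ∘ suc) n) onePlus) (onePlus (f 0)) ⟩
  onePlus (f 0) ⋆ prodS (applyUpTo (f ∘ suc) n) onePlus ∎
  where open ≈-Reasoning

CB≈numer : ∀ n → CB n ≈ numer n
CB≈numer n = ⋆.trans (CB≈genSeries n) (genSeries-allSigns n (λ i → i))

absWeight : ∀ {m} → Vec ℤ m → ℕ
absWeight         []      = 0
absWeight {suc m} (a ∷ x) = m * ∣ a ∣ + absWeight x

muBar-+-sumAbs : ∀ {m} r (x : Vec ℤ m) → muBar (r + sumAbs x) x ≡ m * r + absWeight x
muBar-+-sumAbs         r []      = refl
muBar-+-sumAbs {suc m} r (a ∷ x) = begin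
  (r + (∣ a ∣ + sumAbs x)) ∸ (∣ a ∣ + sumAbs x) + muBar (r + (∣ a ∣ + sumAbs x)) x
    ≡⟨ cong₂ _+_ (m+n∸n≡m r (∣ a ∣ + sumAbs x)) (cong (λ s → muBar s x) (sym (+-assoc r ∣ a ∣ (sumAbs x)))) ⟩
  r + muBar ((r + ∣ a ∣) + sumAbs x) x
    ≡⟨ cong (r +_) (muBar-+-sumAbs (r + ∣ a ∣) x) ⟩
  r + (m * (r + ∣ a ∣) + absWeight x)
    ≡⟨ cong (λ s → r + (s + absWeight x)) (*-distribˡ-+ m r ∣ a ∣) ⟩
  r + ((m * r + m * ∣ a ∣) + absWeight x)
    ≡⟨ cong (r +_) (+-assoc (m * r) _ _) ⟩
  r + (m * r + (m * ∣ a ∣ + absWeight x))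
    ≡⟨ sym (+-assoc r _ _) ⟩
  (r + m * r) + (m * ∣ a ∣ + absWeight x) ∎
  where open ≡-Reasoning

muBar-inDiamond : ∀ {m} k (x : Vec ℤ m) → sumAbs x ≤ k → muBar k x ≡ m * (k ∸ sumAbs x) + absWeight x
muBar-inDiamond k x x∈k◇ =
  trans (cong (λ s → muBar s x) (sym (m∸n+n≡m x∈k◇))) (muBar-+-sumAbs (k ∸ sumAbs x) x)

Ehr≡genSeries-boxVecs⋆geomInv : ∀ n k j →
  Ehr n k j ≡ (genSeries (boxVecs k n) sumAbs absWeight ⋆ geomInv n) k j
Ehr≡genSeries-boxVecs⋆geomInv n k j = trans (sum-map-cong (boxVecs k n) summand)
  (sym (genSeries-⋆ (boxVecs k n) sumAbs absWeight (geomInv n) k j))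
  where
  summand : ∀ x → [ (sumAbs x ≤ᵇ k) ∧ (muBar k x ≡ᵇ j) ]
                ≡ [ (sumAbs x ≤ᵇ k) ∧ (absWeight x ≤ᵇ j) ] * [ j ∸ absWeight x ≡ᵇ n * (k ∸ sumAbs x) ]
  summand x with sumAbs x ≤ᵇ k in x∈k◇
  ... | false = refl
  ... | true  = begin
    [ muBar k x ≡ᵇ j ]                               ≡⟨ cong (λ s → [ s ≡ᵇ j ]) (trans
                                                          (muBar-inDiamond k x (≤ᵇ⇒≤ _ _ (subst T (sym x∈k◇) tt)))
                                                          (+-comm (n * (k ∸ sumAbs x)) (absWeight x))) ⟩
    [ absWeight x + n * (k ∸ sumAbs x) ≡ᵇ j ]        ≡⟨ [+≡ᵇ] (absWeight x) _ j ⟩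
    [ absWeight x ≤ᵇ j ] * [ n * (k ∸ sumAbs x) ≡ᵇ j ∸ absWeight x ]
                                                     ≡⟨ cong (λ b → [ absWeight x ≤ᵇ j ] * [ b ]) (≡ᵇ-comm _ (j ∸ absWeight x)) ⟩
    [ absWeight x ≤ᵇ j ] * [ j ∸ absWeight x ≡ᵇ n * (k ∸ sumAbs x) ] ∎
    where open ≡-Reasoning

infix 4 _≈[≤_]_
_≈[≤_]_ : Series → ℕ → Series → Set
f ≈[≤ K ] g = ∀ k j → k ≤ K → f k j ≡ g k j

⋆-cong-≤ : ∀ {f f′ g g′ K} → f ≈[≤ K ] f′ → g ≈[≤ K ] g′ → (f ⋆ g) ≈[≤ K ] (f′ ⋆ g′)
⋆-cong-≤ f≈f′ g≈g′ k j k≤K = sumTo-cong k (λ a a≤k → sumTo-cong j (λ b _ →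
  cong₂ _*_ (f≈f′ a b (≤-trans a≤k k≤K)) (g≈g′ (k ∸ a) (j ∸ b) (≤-trans (m∸n≤m k a) k≤K))))

-- (1 + q^i t) / (1 - q^i t) = Σ_{a ∈ ℤ} (q^i t)^|a|
twoSided : ℕ → Series
twoSided i = onePlus i ⋆ geomInv i

sum-map-applyUpTo : ∀ n (g f : ℕ → ℕ) → sum (map f (applyUpTo g (suc n))) ≡ sumTo n (f ∘ g)
sum-map-applyUpTo zero    g f = +-identityʳ (f (g 0))
sum-map-applyUpTo (suc n) g f =
  trans (cong (f (g 0) +_) (sum-map-applyUpTo n (g ∘ suc) f)) (sym (sumTo-suc n (f ∘ g)))

sum-upTo-point : ∀ K k (c : ℕ → Bool) → k ≤ K → sum (map (λ i → [ (i ≡ᵇ k) ∧ c i ]) (upTo (suc K))) ≡ [ c k ]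
sum-upTo-point K k c k≤K = begin
  sum (map (λ i → [ (i ≡ᵇ k) ∧ c i ]) (upTo (suc K))) ≡⟨ sum-map-applyUpTo K (λ i → i) _ ⟩
  sumTo K (λ i → [ (i ≡ᵇ k) ∧ c i ])                  ≡⟨ sumTo-cong K (λ i _ → trans ([∧] (i ≡ᵇ k) (c i))
                                                           (cong (λ b → [ b ] * [ c i ]) (≡ᵇ-comm i k))) ⟩
  sumTo K (λ i → [ k ≡ᵇ i ] * [ c i ])                ≡⟨ sumTo-δ K k (λ i → [ c i ]) ⟩
  [ k ≤ᵇ K ] * [ c k ]                                ≡⟨ cong (λ b → [ b ] * [ c k ]) (≤⇒≤ᵇ≡true k≤K) ⟩
  1 * [ c k ]                                         ≡⟨ *-identityˡ [ c k ] ⟩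
  [ c k ]                                             ∎
  where open ≡-Reasoning

genSeries-intRange : ∀ K m → genSeries (intRange K) ∣_∣ (λ a → m * ∣ a ∣) ≈[≤ K ] twoSided m
genSeries-intRange K m k j k≤K = begin
  genSeries (intRange K) ∣_∣ (λ a → m * ∣ a ∣) k j
    ≡⟨ sum-map-++ (map ℤ.+_ (upTo (suc K))) (map ℤ.-[1+_] (upTo K)) _ ⟩
  sum (map _ (map ℤ.+_ (upTo (suc K)))) + sum (map _ (map ℤ.-[1+_] (upTo K)))
    ≡⟨ cong₂ _+_ (cong sum (sym (map-∘ (upTo (suc K))))) (cong sum (sym (map-∘ (upTo K)))) ⟩
  sum (map (λ i → [ (i ≡ᵇ k) ∧ (m * i ≡ᵇ j) ]) (upTo (suc K)))
    + sum (map (λ i → [ (suc i ≡ᵇ k) ∧ (m * suc i ≡ᵇ j) ]) (upTo K))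
    ≡⟨ cases k k≤K ⟩
  [ j ≡ᵇ m * k ] + ([ (1 ≤ᵇ k) ∧ (m ≤ᵇ j) ] * geomInv m (k ∸ 1) (j ∸ m) + 0)
    ≡⟨ cong (_+ ([ (1 ≤ᵇ k) ∧ (m ≤ᵇ j) ] * geomInv m (k ∸ 1) (j ∸ m) + 0)) (sym (*-identityˡ [ j ≡ᵇ m * k ])) ⟩
  1 * [ j ≡ᵇ m * k ] + ([ (1 ≤ᵇ k) ∧ (m ≤ᵇ j) ] * geomInv m (k ∸ 1) (j ∸ m) + 0)
    ≡⟨ genSeries-⋆ (true ∷ false ∷ []) (negPart 1) (negPart m) (geomInv m) k j ⟨
  (genSeries (true ∷ false ∷ []) (negPart 1) (negPart m) ⋆ geomInv m) k j
    ≡⟨ sym (⋆-congʳ (geomInv m) (onePlus≈genSeries m) k j) ⟩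
  twoSided m k j ∎
  where
  open ≡-Reasoning
  cases : ∀ k → k ≤ K →
    sum (map (λ i → [ (i ≡ᵇ k) ∧ (m * i ≡ᵇ j) ]) (upTo (suc K)))
      + sum (map (λ i → [ (suc i ≡ᵇ k) ∧ (m * suc i ≡ᵇ j) ]) (upTo K))
    ≡ [ j ≡ᵇ m * k ] + ([ (1 ≤ᵇ k) ∧ (m ≤ᵇ j) ] * geomInv m (k ∸ 1) (j ∸ m) + 0)
  cases zero    _ = cong₂ _+_ (trans (sum-upTo-point K 0 (λ i → m * i ≡ᵇ j) z≤n) (cong [_] (≡ᵇ-comm (m * 0) j)))
                              (sum-map-zero (upTo K))
  cases (suc k) (s≤s {n = K′} k≤K′) = cong₂ _+_
    (trans (sum-upTo-point K (suc k) (λ i → m * i ≡ᵇ j) (s≤s k≤K′)) (cong [_] (≡ᵇ-comm (m * suc k) j)))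
    (begin
      sum (map (λ i → [ (i ≡ᵇ k) ∧ (m * suc i ≡ᵇ j) ]) (upTo (suc K′))) ≡⟨ sum-upTo-point K′ k (λ i → m * suc i ≡ᵇ j) k≤K′ ⟩
      [ m * suc k ≡ᵇ j ]                                                ≡⟨ cong (λ s → [ s ≡ᵇ j ]) (*-suc m k) ⟩
      [ m + m * k ≡ᵇ j ]                                                ≡⟨ [+≡ᵇ] m (m * k) j ⟩
      [ m ≤ᵇ j ] * [ m * k ≡ᵇ j ∸ m ]                                   ≡⟨ cong (λ b → [ m ≤ᵇ j ] * [ b ]) (≡ᵇ-comm (m * k) (j ∸ m)) ⟩
      [ m ≤ᵇ j ] * [ j ∸ m ≡ᵇ m * k ]                                   ≡⟨ +-identityʳ _ ⟨
      [ m ≤ᵇ j ] * [ j ∸ m ≡ᵇ m * k ] + 0                               ∎)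

genSeries-boxVecs : ∀ K m → genSeries (boxVecs K m) sumAbs absWeight ≈[≤ K ] prodS (downFrom m) twoSided
genSeries-boxVecs K zero    k j _   = genSeries-singleton {A = Vec ℤ 0} [] k j
genSeries-boxVecs K (suc m) k j k≤K = trans
  (genSeries-concatMap (intRange K) (boxVecs K m) _∷_
     {sumAbs} {absWeight} {∣_∣} {λ a → m * ∣ a ∣} {sumAbs} {absWeight} (λ _ _ → refl) (λ _ _ → refl) k j)
  (⋆-cong-≤ (genSeries-intRange K m) (genSeries-boxVecs K m) k j k≤K)

numer⋆invDenom≈prodS-twoSided : ∀ n → (numer n ⋆ invDenom n) ≈ (prodS (downFrom n) twoSided ⋆ geomInv n)
numer⋆invDenom≈prodS-twoSided n = begin
  numer n ⋆ invDenom n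
    ≈⟨ ⋆-congˡ (numer n) (prodS-upTo-suc n geomInv) ⟩
  numer n ⋆ (prodS (upTo n) geomInv ⋆ geomInv n)
    ≈⟨ ⋆-assoc (numer n) (prodS (upTo n) geomInv) (geomInv n) ⟨
  (numer n ⋆ prodS (upTo n) geomInv) ⋆ geomInv n
    ≈⟨ ⋆-congʳ (geomInv n) (prodS-⋆-distrib (upTo n) onePlus geomInv) ⟨
  prodS (upTo n) twoSided ⋆ geomInv n
    ≈⟨ ⋆-congʳ (geomInv n) (prodS-upTo≈downFrom n twoSided) ⟩
  prodS (downFrom n) twoSided ⋆ geomInv n ∎
  where open ≈-Reasoning

corollary3p3 : (n : ℕ) →
    ((k j : ℕ) → (CB n ⋆ invDenom n) k j ≡ (numer n ⋆ invDenom n) k j)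
    × ((k j : ℕ) → (numer n ⋆ invDenom n) k j ≡ Ehr n k j)
corollary3p3 n = ⋆-congʳ (invDenom n) (CB≈numer n) , λ k j → begin
  (numer n ⋆ invDenom n) k j                                ≡⟨ numer⋆invDenom≈prodS-twoSided n k j ⟩
  (prodS (downFrom n) twoSided ⋆ geomInv n) k j             ≡⟨ ⋆-cong-≤ {g = geomInv n} (λ k′ j′ k′≤k → sym (genSeries-boxVecs k n k′ j′ k′≤k))
                                                                        (λ _ _ _ → refl) k j ≤-refl ⟩
  (genSeries (boxVecs k n) sumAbs absWeight ⋆ geomInv n) k j ≡⟨ Ehr≡genSeries-boxVecs⋆geomInv n k j ⟨
  Ehr n k j                                                 ∎
  where open ≡-Reasoning
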